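{- Let $(l_n)_{n\in\mathbb{N}}$ be the increasing sequence with $\{l_n:n\in\mathbb{N}\}=\{m\in\mathbb{N}: b_m=1\}$. Then $(l_n)$ is not $k$-regular for any integer $k\ge2$.
   Context: The Baum--Sweet sequence $(b_n)_{n\in\mathbb{N}}$ is defined by $b_0=1$ and, for $n\ge1$, $b_n=0$ if the binary expansion of $n$ contains a maximal block of consecutive $0$'s of odd length, and $b_n=1$ otherwise. An integer sequence $(u_n)$ is $k$-regular if there are finitely many integer sequences $s^{(1)},\dots,s^{(m)}$ such that every sequence $(u_{k^in+j})_{n}$ with $i\ge0$, $0\le j<k^i$ is a $\mathbb{Z}$-linear combination of $s^{(1)},\dots,s^{(m)}$. -}

module Defs where

open import Data.Nat using (ℕ; zero; suc; _+_; _*_; _^_; _<_; _%_; _/_)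
open import Data.Nat.Properties using (_≟_)
open import Data.Bool using (Bool; true; false; if_then_else_)
open import Data.List using (List; []; _∷_; _++_)
open import Data.Fin using (Fin)
import Data.Fin as Fin
open import Data.Integer using (ℤ; +_) renaming (_+_ to _+ℤ_; _*_ to _*ℤ_)
open import Data.Product using (Σ; ∃; _×_)
open import Relation.Binary.PropositionalEquality using (_≡_)
open import Relation.Nullary using (does)

-- Binary digits of n, least significant first (true = 1, false = 0),
-- without leading zeros; the fuel argument (= n) is always sufficient.
bitsAux : ℕ → ℕ → List Bool
bitsAux zero    n = []
bitsAux (suc f) n with n ≟ 0
... | Relation.Nullary.yes _ = []
... | Relation.Nullary.no  _ = does (n % 2 ≟ 1) ∷ bitsAux f (n / 2)

bits : ℕ → List Bool
bits n = bitsAux n n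

flush : ℕ → List ℕ
flush zero    = []
flush (suc c) = suc c ∷ []

zeroBlocksAux : ℕ → List Bool → List ℕ
zeroBlocksAux c []           = flush c
zeroBlocksAux c (false ∷ xs) = zeroBlocksAux (suc c) xs
zeroBlocksAux c (true ∷ xs)  = flush c ++ zeroBlocksAux 0 xs

zeroBlocks : List Bool → List ℕ
zeroBlocks = zeroBlocksAux 0

isOdd : ℕ → Bool
isOdd n = does (n % 2 ≟ 1)

anyOdd : List ℕ → Bool
anyOdd []       = false
anyOdd (x ∷ xs) = if isOdd x then true else anyOdd xs

baumSweet : ℕ → ℕ
baumSweet zero    = 1
baumSweet (suc n) = if anyOdd (zeroBlocks (bits (suc n))) then 0 else 1

Σℤ : (m : ℕ) → (Fin m → ℤ) → ℤ
Σℤ zero    f = + 0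
Σℤ (suc m) f = f Fin.zero +ℤ Σℤ m (λ r → f (Fin.suc r))

-- k-regularity of an integer sequence: finitely many integer sequences
-- s(1..m) such that every k-kernel subsequence is a ℤ-linear combination of them.
IsRegular : ℕ → (ℕ → ℤ) → Set
IsRegular k u =
  Σ ℕ λ m → Σ (Fin m → ℕ → ℤ) λ s →
    ∀ (i j : ℕ) → j < k ^ i →
      Σ (Fin m → ℤ) λ c →
        ∀ (n : ℕ) → u (k ^ i * n + j) ≡ Σℤ m (λ r → c r *ℤ s r n)

module Submission where

-- If l were k-regular with a kernel spanned by m sequences, then for
-- K = k^(m+1) > m the K sequences n ↦ l (K n + j) would satisfy a common nontrivial
-- integer relation Σ_{j ≤ s} d j · l (K n + j) = 0 with d s ≠ 0 (linear algebra
-- over ℤ).  Such a relation is impossible at any n for which l (K n), …,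
-- l (K n + s - 1) lie in a short window [z, z + w) and l (K n + s) = z + Δ lies
-- far beyond it (gap-contradiction).  The combinatorics of b provides such
-- configurations for every K, s < K and scale: b(x·2^t + y) depends on the
-- prefix x only through (b x, b (2x)), so counts of ones in dyadic blocks are
-- Fibonacci numbers; their periodicity modulo K lets us place a long empty
-- stretch of numbers right after the index K n + s - 1 (GapAfterGoodPrefix,
-- ResidueControl, gapConfiguration).

open import Defs
open import Data.Nat
open import Data.Nat.Properties
open import Data.Nat.DivMod
open import Data.Nat.Divisibility using (divides-refl)
open import Data.Nat.Tactic.RingSolver using (solve-∀)
open import Data.Bool using (Bool; true; false; if_then_else_)
open import Data.List using (List; []; _∷_)
open import Data.Product using (Σ; ∃; _,_; _×_; proj₁; proj₂)
open import Data.Sum using (_⊎_; inj₁; inj₂)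
open import Data.Empty using (⊥; ⊥-elim)
open import Function.Bundles using (_⇔_; Equivalence)
open import Relation.Binary.Definitions using (tri<; tri≈; tri>)
open import Relation.Binary.PropositionalEquality
open import Relation.Nullary using (¬_; Dec; yes; no; does; ¬?)
open import Relation.Nullary.Decidable using (decidable-stable)
open import Data.Fin using (Fin; toℕ; fromℕ; fromℕ<; combine; punchIn; inject₁)
open import Data.Vec.Functional using (insertAt)
open import Data.Vec.Functional.Properties using (insertAt-lookup; insertAt-punchIn)
import Data.Fin.Properties as Fin
open import Data.Integer using (ℤ; +_; ∣_∣)
  renaming (_+_ to _+ℤ_; _*_ to _*ℤ_; _-_ to _-ℤ_; -_ to -ℤ_)
import Data.Integer.Properties as ℤ
open import Algebra.Properties.Semiring.Sum ℤ.+-*-semiring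
  using (sum; sum-init-last; sum-cong-≗; sum-remove; ∑-distrib-+; ∑-comm; *-distribˡ-sum; *-distribʳ-sum; sum-replicate-zero)
open import Data.Integer.Divisibility.Signed using (divides; ∣m+n∣m⇒∣n; ∣m∣n⇒∣m+n; ∣⇒∣ᵤ)
  renaming (_∣_ to _∣ℤ_)
import Data.Nat.Divisibility as ℕ
open import Data.Integer.Tactic.RingSolver renaming (solve-∀ to solveℤ-∀)

b : ℕ → ℕ
b = baumSweet

b∈01 : ∀ x → b x ≡ 0 ⊎ b x ≡ 1
b∈01 zero = inj₂ refl
b∈01 (suc x) with anyOdd (zeroBlocks (bits (suc x)))
... | true  = inj₁ refl
... | false = inj₂ refl

bitsAux-fuel : ∀ f g n → n ≤ f → n ≤ g → bitsAux f n ≡ bitsAux g n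
bitsAux-fuel zero    zero    n       _   _   = refl
bitsAux-fuel zero    (suc g) .zero   z≤n _   = refl
bitsAux-fuel (suc f) zero    .zero   _   z≤n = refl
bitsAux-fuel (suc f) (suc g) n       n≤f n≤g with n ≟ 0
... | yes _  = refl
... | no n≢0 = cong (does (n % 2 ≟ 1) ∷_) (bitsAux-fuel f g (n / 2) (half n≤f) (half n≤g))
  where
  half : ∀ {k} → n ≤ suc k → n / 2 ≤ k
  half n≤1+k = ≤-pred (≤-trans (m/n<m n 2 {{≢-nonZero n≢0}} ≤-refl) n≤1+k)

bitsAux-step : ∀ f n → n ≢ 0 → bitsAux (suc f) n ≡ does (n % 2 ≟ 1) ∷ bitsAux f (n / 2)
bitsAux-step f n n≢0 with n ≟ 0
... | yes n≡0 = ⊥-elim (n≢0 n≡0)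
... | no _    = refl

bits-odd : ∀ n → bits (1 + n * 2) ≡ true ∷ bits n
bits-odd n = trans (bitsAux-step (n * 2) (1 + n * 2) (λ ()))
  (cong₂ _∷_ (cong (λ r → does (r ≟ 1)) ([m+kn]%n≡m%n 1 n 2))
    (trans (cong (bitsAux (n * 2)) half) (bitsAux-fuel (n * 2) n n (m≤m*n n 2) ≤-refl)))
  where
  half : (1 + n * 2) / 2 ≡ n
  half = trans (+-distrib-/-∣ʳ 1 {d = 2} (divides-refl n)) (m*n/n≡m n 2)

bits-even : ∀ n → bits (suc n * 2) ≡ false ∷ bits (suc n)
bits-even n = trans (bitsAux-step (suc (n * 2)) (suc n * 2) (λ ()))
  (cong₂ _∷_ (cong (λ r → does (r ≟ 1)) (m*n%n≡0 (suc n) 2))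
    (trans (cong (bitsAux (suc (n * 2))) (m*n/n≡m (suc n) 2))
      (bitsAux-fuel _ (suc n) (suc n) (s≤s (m≤m*n n 2)) ≤-refl)))

anyOdd-+2 : ∀ c xs → anyOdd (zeroBlocksAux (2 + c) xs) ≡ anyOdd (zeroBlocksAux c xs)
anyOdd-+2 zero    []           = refl
anyOdd-+2 (suc c) []           = refl
anyOdd-+2 c       (false ∷ xs) = anyOdd-+2 (suc c) xs
anyOdd-+2 zero    (true ∷ xs)  = refl
anyOdd-+2 (suc c) (true ∷ xs)  = refl

bsOf : List Bool → ℕ
bsOf ds = if anyOdd (zeroBlocks ds) then 0 else 1

b-odd : ∀ n → b (1 + n * 2) ≡ b n
b-odd zero    = refl
b-odd (suc n) = cong bsOf (bits-odd (suc n))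

b-4n : ∀ n → b (n * 4) ≡ b n
b-4n zero    = refl
b-4n (suc n) = trans (cong bsOf digits) (cong (λ o → if o then 0 else 1) (anyOdd-+2 0 (bits (suc n))))
  where
  digits : bits (suc n * 4) ≡ false ∷ false ∷ bits (suc n)
  digits = trans (cong bits (arith n)) (trans (bits-even (suc (n * 2))) (cong (false ∷_) (bits-even n)))
    where
    arith : ∀ n → suc n * 4 ≡ suc (suc (n * 2)) * 2
    arith = solve-∀

b-4n+2 : ∀ n → b (2 + n * 4) ≡ 0
b-4n+2 n = cong bsOf digits
  where
  digits : bits (2 + n * 4) ≡ false ∷ true ∷ bits n
  digits = trans (cong bits (arith n)) (trans (bits-even (n * 2)) (cong (false ∷_) (bits-odd n)))
    where
    arith : ∀ n → 2 + n * 4 ≡ suc (n * 2) * 2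
    arith = solve-∀

-- Digits t y: y < 2^t, viewed as a string of t binary digits built from the
-- least significant end.  Induction on it drives the prefix lemmas below.
data Digits : ℕ → ℕ → Set where
  empty : Digits 0 0
  app1  : ∀ {t y} → Digits t y → Digits (suc t) (1 + y * 2)
  app0  : ∀ {t y} → Digits t y → Digits (suc t) (y * 2)

evenOrOdd : ∀ y → (Σ ℕ λ q → y ≡ q * 2) ⊎ (Σ ℕ λ q → y ≡ 1 + q * 2)
evenOrOdd zero = inj₁ (0 , refl)
evenOrOdd (suc y) with evenOrOdd y
... | inj₁ (q , y≡2q)   = inj₂ (q , cong suc y≡2q)
... | inj₂ (q , y≡2q+1) = inj₁ (suc q , cong suc y≡2q+1)

halve< : ∀ q t → q * 2 < 2 ^ suc t → q < 2 ^ t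
halve< q t lt = *-cancelʳ-< _ q (2 ^ t) (subst (q * 2 <_) (*-comm 2 (2 ^ t)) lt)

digits : ∀ t y → y < 2 ^ t → Digits t y
digits zero    zero    _  = empty
digits zero    (suc y) (s≤s ())
digits (suc t) y       lt with evenOrOdd y
... | inj₁ (q , refl) = app0 (digits t q (halve< q t lt))
... | inj₂ (q , refl) = app1 (digits t q (halve< q t (<-trans (n<1+n _) lt)))

bp : ℕ → ℕ → ℕ → ℕ
bp x t y = b (x * 2 ^ t + y)

bp-empty : ∀ x → bp x 0 0 ≡ b x
bp-empty x = cong b (trans (+-identityʳ (x * 1)) (*-identityʳ x))

bp-app1 : ∀ x t y → bp x (suc t) (1 + y * 2) ≡ bp x t y
bp-app1 x t y = trans (cong b (arith x (2 ^ t) y)) (b-odd (x * 2 ^ t + y))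
  where
  arith : ∀ x P y → x * (2 * P) + (1 + y * 2) ≡ 1 + (x * P + y) * 2
  arith = solve-∀

bp-app00 : ∀ x t y → bp x (2 + t) ((y * 2) * 2) ≡ bp x t y
bp-app00 x t y = trans (cong b (arith x (2 ^ t) y)) (b-4n (x * 2 ^ t + y))
  where
  arith : ∀ x P y → x * (2 * (2 * P)) + (y * 2) * 2 ≡ (x * P + y) * 4
  arith = solve-∀

bp-app10 : ∀ x t y → bp x (2 + t) ((1 + y * 2) * 2) ≡ 0
bp-app10 x t y = trans (cong b (arith x (2 ^ t) y)) (b-4n+2 (x * 2 ^ t + y))
  where
  arith : ∀ x P y → x * (2 * (2 * P)) + (1 + y * 2) * 2 ≡ 2 + (x * P + y) * 4
  arith = solve-∀

bp-app0 : ∀ x → bp x 1 0 ≡ b (x * 2)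
bp-app0 x = cong b (+-identityʳ (x * 2))

prefix-invariance : ∀ x x' {t y} → b x ≡ b x' → b (x * 2) ≡ b (x' * 2) →
                    Digits t y → bp x t y ≡ bp x' t y
prefix-invariance x x' same same2 empty =
  trans (bp-empty x) (trans same (sym (bp-empty x')))
prefix-invariance x x' same same2 (app1 {t} {y} d) =
  trans (bp-app1 x t y) (trans (prefix-invariance x x' same same2 d) (sym (bp-app1 x' t y)))
prefix-invariance x x' same same2 (app0 empty) =
  trans (bp-app0 x) (trans same2 (sym (bp-app0 x')))
prefix-invariance x x' same same2 (app0 (app1 {t} {y} d)) =
  trans (bp-app10 x t y) (sym (bp-app10 x' t y))
prefix-invariance x x' same same2 (app0 (app0 {t} {y} d)) =
  trans (bp-app00 x t y) (trans (prefix-invariance x x' same same2 d) (sym (bp-app00 x' t y)))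

prefix-zero : ∀ x {t y} → b x ≡ 0 → b (x * 2) ≡ 0 → Digits t y → bp x t y ≡ 0
prefix-zero x zero1 zero2 empty = trans (bp-empty x) zero1
prefix-zero x zero1 zero2 (app1 {t} {y} d) = trans (bp-app1 x t y) (prefix-zero x zero1 zero2 d)
prefix-zero x zero1 zero2 (app0 empty) = trans (bp-app0 x) zero2
prefix-zero x zero1 zero2 (app0 (app1 {t} {y} d)) = bp-app10 x t y
prefix-zero x zero1 zero2 (app0 (app0 {t} {y} d)) = trans (bp-app00 x t y) (prefix-zero x zero1 zero2 d)

-- Good x: as a binary prefix, x behaves exactly like the prefix 1.
record Good (x : ℕ) : Set where
  constructor good
  field
    b≡1  : b x ≡ 1
    b2≡0 : b (x * 2) ≡ 0

good-prefix : ∀ {x} → Good x → ∀ t y → y < 2 ^ t → b (x * 2 ^ t + y) ≡ b (2 ^ t + y)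
good-prefix {x} (good b≡1 b2≡0) t y y<2^t =
  trans (prefix-invariance x 1 b≡1 b2≡0 (digits t y y<2^t))
        (cong (λ P → b (P + y)) (*-identityˡ (2 ^ t)))

good-1 : Good 1
good-1 = good refl refl

good-3 : Good 3
good-3 = good refl refl

good-4 : Good 4
good-4 = good refl refl

b-·4^ : ∀ x g → b (x * 2 ^ (g * 2)) ≡ b x
b-·4^ x zero    = cong b (*-identityʳ x)
b-·4^ x (suc g) = trans (cong b (arith x (2 ^ (g * 2)))) (trans (b-4n (x * 2 ^ (g * 2))) (b-·4^ x g))
  where
  arith : ∀ x P → x * (2 * (2 * P)) ≡ x * P * 4
  arith = solve-∀

good-·4^ : ∀ {x} → Good x → ∀ g → Good (x * 2 ^ (g * 2))
good-·4^ {x} (good b≡1 b2≡0) g = good (trans (b-·4^ x g) b≡1)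
  (trans (cong b (arith x (2 ^ (g * 2)))) (trans (b-·4^ (x * 2) g) b2≡0))
  where
  arith : ∀ x P → x * P * 2 ≡ x * 2 * P
  arith = solve-∀

good-odd : ∀ y → b y ≡ 1 → Good (1 + y * 2)
good-odd y b≡1 = good (trans (b-odd y) b≡1) (trans (cong b (arith y)) (b-4n+2 y))
  where
  arith : ∀ y → (1 + y * 2) * 2 ≡ 2 + y * 4
  arith = solve-∀

cnt : ℕ → ℕ → ℕ
cnt a zero    = 0
cnt a (suc z) = cnt a z + b (a + z)

c : ℕ → ℕ
c = cnt 0

cnt-split : ∀ a z₁ z₂ → cnt a (z₁ + z₂) ≡ cnt a z₁ + cnt (a + z₁) z₂
cnt-split a z₁ zero     = trans (cong (cnt a) (+-identityʳ z₁)) (sym (+-identityʳ _))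
cnt-split a z₁ (suc z₂) = trans (cong (cnt a) (+-suc z₁ z₂))
  (trans (cong₂ _+_ (cnt-split a z₁ z₂) (cong b (sym (+-assoc a z₁ z₂)))) (+-assoc (cnt a z₁) _ _))

cnt-cong : ∀ a a' z → (∀ y → y < z → b (a + y) ≡ b (a' + y)) → cnt a z ≡ cnt a' z
cnt-cong a a' zero    same = refl
cnt-cong a a' (suc z) same = cong₂ _+_ (cnt-cong a a' z (λ y y<z → same y (m<n⇒m<1+n y<z))) (same z ≤-refl)

cnt-vanish : ∀ a z → (∀ y → y < z → b (a + y) ≡ 0) → cnt a z ≡ 0
cnt-vanish a zero    zeros = refl
cnt-vanish a (suc z) zeros = cong₂ _+_ (cnt-vanish a z (λ y y<z → zeros y (m<n⇒m<1+n y<z))) (zeros z ≤-refl)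

cnt-good : ∀ {x} → Good x → ∀ t z → z ≤ 2 ^ t → cnt (x * 2 ^ t) z ≡ cnt (2 ^ t) z
cnt-good g t z z≤2^t = cnt-cong _ _ z (λ y y<z → good-prefix g t y (<-≤-trans y<z z≤2^t))

cnt-zero-prefix : ∀ x → b x ≡ 0 → b (x * 2) ≡ 0 → ∀ t → cnt (x * 2 ^ t) (2 ^ t) ≡ 0
cnt-zero-prefix x zero1 zero2 t = cnt-vanish _ _ (λ y y<2^t → prefix-zero x zero1 zero2 (digits t y y<2^t))

-- Fibonacci numbers, shifted so that fib 0 = fib 1 = 1.
fib : ℕ → ℕ
fib 0             = 1
fib 1             = 1
fib (suc (suc n)) = fib (suc n) + fib n

cnt-next : ∀ x Q z → cnt (x * Q) (Q + z) ≡ cnt (x * Q) Q + cnt (suc x * Q) z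
cnt-next x Q z = trans (cnt-split (x * Q) Q z) (cong (λ a → cnt (x * Q) Q + cnt a z) (+-comm (x * Q) Q))

cnt-101 : ∀ t → cnt (5 * 2 ^ t) (2 ^ t) ≡ 0
cnt-101 = cnt-zero-prefix 5 refl refl

-- The block [2^t, 2^(t+1)) contains fib t ones: its quarters have the
-- prefixes 100, 101 and 11, behaving like 1, nothing and 1 respectively.
cnt-pow : ∀ t → cnt (2 ^ t) (2 ^ t) ≡ fib t
cnt-pow 0       = refl
cnt-pow 1       = refl
cnt-pow (suc (suc t)) = begin
  cnt (2 ^ (2 + t)) (2 ^ (2 + t))               ≡⟨ cong₂ cnt (quadruple Q) (split Q) ⟩
  cnt (4 * Q) (Q + (Q + 2 ^ (1 + t)))           ≡⟨ cnt-next 4 Q _ ⟩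
  cnt (4 * Q) Q + cnt (5 * Q) (Q + 2 ^ (1 + t)) ≡⟨ cong (_+_ (cnt (4 * Q) Q)) (cnt-next 5 Q _) ⟩
  cnt (4 * Q) Q + (cnt (5 * Q) Q + cnt (6 * Q) (2 ^ (1 + t)))
    ≡⟨ cong₂ (λ u v → u + (v + cnt (6 * Q) (2 ^ (1 + t)))) (cnt-good good-4 t Q ≤-refl) (cnt-101 t) ⟩
  cnt Q Q + cnt (6 * Q) (2 ^ (1 + t))            ≡⟨ cong (λ a → cnt Q Q + cnt a (2 ^ (1 + t))) (sextuple Q) ⟩
  cnt Q Q + cnt (3 * 2 ^ (1 + t)) (2 ^ (1 + t))  ≡⟨ cong₂ _+_ (cnt-pow t) (trans (cnt-good good-3 (1 + t) _ ≤-refl) (cnt-pow (suc t))) ⟩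
  fib t + fib (suc t)                           ≡⟨ +-comm (fib t) _ ⟩
  fib (suc t) + fib t                           ∎
  where
  open ≡-Reasoning
  Q = 2 ^ t
  quadruple : ∀ Q → 2 * (2 * Q) ≡ 4 * Q
  quadruple = solve-∀
  split : ∀ Q → 2 * (2 * Q) ≡ Q + (Q + 2 * Q)
  split = solve-∀
  sextuple : ∀ Q → 6 * Q ≡ 3 * (2 * Q)
  sextuple = solve-∀

-- Counting from 0: c (2^t) = 1 + fib 0 + ... + fib (t - 1) = fib (t + 1).
c-pow : ∀ t → c (2 ^ t) ≡ fib (suc t)
c-pow zero    = refl
c-pow (suc t) = trans (cong c (double (2 ^ t))) (trans (cnt-split 0 (2 ^ t) (2 ^ t))
  (trans (cong₂ _+_ (c-pow t) (cnt-pow t)) refl))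
  where
  double : ∀ Q → 2 * Q ≡ Q + Q
  double = solve-∀

-- The first half [2^(t+2), 2^(t+2) + 2^(t+1)) of a block: prefixes 100 and 101.
cnt-first-half : ∀ t → cnt (2 ^ (2 + t)) (2 ^ (1 + t)) ≡ fib t
cnt-first-half t = begin
  cnt (2 ^ (2 + t)) (2 ^ (1 + t))     ≡⟨ cong₂ cnt (quadruple Q) (double Q) ⟩
  cnt (4 * Q) (Q + Q)                 ≡⟨ cnt-next 4 Q Q ⟩
  cnt (4 * Q) Q + cnt (5 * Q) Q        ≡⟨ cong₂ _+_ (cnt-good good-4 t Q ≤-refl) (cnt-101 t) ⟩
  cnt Q Q + 0                         ≡⟨ trans (+-identityʳ _) (cnt-pow t) ⟩
  fib t                               ∎
  where
  open ≡-Reasoning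
  Q = 2 ^ t
  quadruple : ∀ Q → 2 * (2 * Q) ≡ 4 * Q
  quadruple = solve-∀
  double : ∀ Q → 2 * Q ≡ Q + Q
  double = solve-∀

-- Three quarters of the block of 2^(t+3): prefixes 100, 101 and 110.
cnt-three-quarters : ∀ t → cnt (2 ^ (3 + t)) (3 * 2 ^ (1 + t)) ≡ fib (2 + t)
cnt-three-quarters t = begin
  cnt (2 ^ (3 + t)) (3 * Q)                     ≡⟨ cong₂ cnt (quadruple Q) (triple Q) ⟩
  cnt (4 * Q) (Q + (Q + Q))                     ≡⟨ cnt-next 4 Q _ ⟩
  cnt (4 * Q) Q + cnt (5 * Q) (Q + Q)           ≡⟨ cong (_+_ (cnt (4 * Q) Q)) (cnt-next 5 Q Q) ⟩
  cnt (4 * Q) Q + (cnt (5 * Q) Q + cnt (6 * Q) Q)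
    ≡⟨ cong₂ (λ u v → u + (v + cnt (6 * Q) Q)) (cnt-good good-4 (1 + t) Q ≤-refl) (cnt-101 (1 + t)) ⟩
  cnt Q Q + cnt (6 * Q) Q                        ≡⟨ cong (λ a → cnt Q Q + cnt a Q) (sextuple (2 ^ t)) ⟩
  cnt Q Q + cnt (3 * 2 ^ (2 + t)) Q              ≡⟨ cong (_+_ (cnt Q Q)) (cnt-good good-3 (2 + t) Q (m≤n*m Q 2)) ⟩
  cnt Q Q + cnt (2 ^ (2 + t)) Q                  ≡⟨ cong₂ _+_ (cnt-pow (1 + t)) (cnt-first-half t) ⟩
  fib (1 + t) + fib t                            ∎
  where
  open ≡-Reasoning
  Q = 2 ^ (1 + t)
  quadruple : ∀ Q → 2 * (2 * Q) ≡ 4 * Q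
  quadruple = solve-∀
  triple : ∀ Q → 3 * Q ≡ Q + (Q + Q)
  triple = solve-∀
  sextuple : ∀ P → 6 * (2 * P) ≡ 3 * (2 * (2 * P))
  sextuple = solve-∀

FibCong : ℕ → ℕ → ℕ → Set
FibCong K i j = + K ∣ℤ (+ fib j -ℤ + fib i)

fib-step : ∀ n → + fib (2 + n) ≡ + fib (1 + n) +ℤ + fib n
fib-step n = ℤ.pos-+ (fib (1 + n)) (fib n)

fib-diff : ∀ i j → + fib (2 + i) -ℤ + fib (2 + j) ≡ (+ fib (1 + i) -ℤ + fib (1 + j)) +ℤ (+ fib i -ℤ + fib j)
fib-diff i j = trans (cong₂ _-ℤ_ (fib-step i) (fib-step j)) (rearrange (+ fib (1 + i)) (+ fib i) (+ fib (1 + j)) (+ fib j))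
  where
  rearrange : ∀ a b c d → (a +ℤ b) -ℤ (c +ℤ d) ≡ (a -ℤ c) +ℤ (b -ℤ d)
  rearrange = solveℤ-∀

fibCong-back : ∀ K i j → FibCong K (2 + i) (2 + j) → FibCong K (1 + i) (1 + j) → FibCong K i j
fibCong-back K i j h₂ h₁ = ∣m+n∣m⇒∣n (subst (+ K ∣ℤ_) (fib-diff j i) h₂) h₁

fibCong-forward : ∀ K i j → FibCong K i j → FibCong K (1 + i) (1 + j) → FibCong K (2 + i) (2 + j)
fibCong-forward K i j h₀ h₁ = subst (+ K ∣ℤ_) (sym (fib-diff j i)) (∣m∣n⇒∣m+n h₁ h₀)

ShiftPair : ℕ → ℕ → ℕ → Set
ShiftPair K d i = FibCong K i (i + d) × FibCong K (1 + i) (1 + i + d)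

shiftPair-to-0 : ∀ K d i → ShiftPair K d i → ShiftPair K d 0
shiftPair-to-0 K d zero    h         = h
shiftPair-to-0 K d (suc i) (h₀ , h₁) = shiftPair-to-0 K d i (fibCong-back K i (i + d) h₁ h₀ , h₀)

shiftPair-from-0 : ∀ K d → ShiftPair K d 0 → ∀ n → ShiftPair K d n
shiftPair-from-0 K d h zero    = h
shiftPair-from-0 K d h (suc n) with shiftPair-from-0 K d h n
... | h₀ , h₁ = h₁ , fibCong-forward K n (n + d) h₀ h₁

%-cong : ∀ K .{{_ : NonZero K}} a b → a % K ≡ b % K → + K ∣ℤ (+ a -ℤ + b)
%-cong K a b same = divides (+ (a / K) -ℤ + (b / K)) (begin
  + a -ℤ + b                                         ≡⟨ cong₂ _-ℤ_ (expand a) (expand b) ⟩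
  (+ (a % K) +ℤ + (a / K) *ℤ + K) -ℤ (+ (b % K) +ℤ + (b / K) *ℤ + K)
    ≡⟨ cong (λ r → (r +ℤ + (a / K) *ℤ + K) -ℤ (+ (b % K) +ℤ + (b / K) *ℤ + K)) (cong +_ same) ⟩
  (+ (b % K) +ℤ + (a / K) *ℤ + K) -ℤ (+ (b % K) +ℤ + (b / K) *ℤ + K)
    ≡⟨ cancel (+ (b % K)) (+ (a / K)) (+ (b / K)) (+ K) ⟩
  (+ (a / K) -ℤ + (b / K)) *ℤ + K                      ∎)
  where
  open ≡-Reasoning
  expand : ∀ m → + m ≡ + (m % K) +ℤ + (m / K) *ℤ + K
  expand m = trans (cong +_ (m≡m%n+[m/n]*n m K))
    (trans (ℤ.pos-+ (m % K) _) (cong (+ (m % K) +ℤ_) (ℤ.pos-* (m / K) K)))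
  cancel : ∀ r x y k → (r +ℤ x *ℤ k) -ℤ (r +ℤ y *ℤ k) ≡ (x -ℤ y) *ℤ k
  cancel = solveℤ-∀

-- Pigeonhole on the K² possible residue pairs gives some shift d ≥ 1.
fib-shiftPair : ∀ K .{{_ : NonZero K}} → Σ ℕ λ d → 1 ≤ d × Σ ℕ (ShiftPair K d)
fib-shiftPair K with Fin.pigeonhole (n<1+n (K * K)) residues
  where
  residues : Fin (suc (K * K)) → Fin (K * K)
  residues i = combine (fromℕ< (m%n<n (fib (toℕ i)) K)) (fromℕ< (m%n<n (fib (suc (toℕ i))) K))
... | i , j , i<j , same =
  d , 0<d , toℕ i , shift (congruent (fib (toℕ i)) (fib (toℕ j)) (proj₁ sameParts))
                  , shift' (congruent (fib (suc (toℕ i))) (fib (suc (toℕ j))) (proj₂ sameParts))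
  where
  sameParts = Fin.combine-injective {m = K} {n = K} _ _ _ _ same
  congruent : ∀ m n → fromℕ< (m%n<n m K) ≡ fromℕ< (m%n<n n K) → + K ∣ℤ (+ n -ℤ + m)
  congruent m n e = %-cong K n m (sym (trans (sym (Fin.toℕ-fromℕ< _)) (trans (cong toℕ e) (Fin.toℕ-fromℕ< _))))
  d = toℕ j ∸ toℕ i
  j≡i+d : toℕ j ≡ toℕ i + d
  j≡i+d = sym (m+[n∸m]≡n (<⇒≤ i<j))
  0<d : 1 ≤ d
  0<d = m<n⇒0<n∸m i<j
  shift : FibCong K (toℕ i) (toℕ j) → FibCong K (toℕ i) (toℕ i + d)
  shift = subst (λ n → FibCong K (toℕ i) n) j≡i+d
  shift' : FibCong K (1 + toℕ i) (1 + toℕ j) → FibCong K (1 + toℕ i) (1 + toℕ i + d)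
  shift' = subst (λ n → FibCong K (1 + toℕ i) (suc n)) j≡i+d

-- a ≅ b mod K: a is b plus a multiple of K (so a ≡ b mod K and b ≤ a).
infix 4 _≅_mod_
record _≅_mod_ (a b K : ℕ) : Set where
  constructor multiple
  field
    quotient : ℕ
    equation : a ≡ b + K * quotient

≅-refl : ∀ {K} a → a ≅ a mod K
≅-refl {K} a = multiple 0 (sym (trans (cong (_+_ a) (*-zeroʳ K)) (+-identityʳ a)))

≅-trans : ∀ {K a b d} → a ≅ b mod K → b ≅ d mod K → a ≅ d mod K
≅-trans {K} {d = d} (multiple A a≡b+KA) (multiple B b≡d+KB) =
  multiple (B + A) (trans a≡b+KA (trans (cong (_+ K * A) b≡d+KB) (regroup d K B A)))
  where
  regroup : ∀ d K B A → d + K * B + K * A ≡ d + K * (B + A)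
  regroup = solve-∀

≅-+ : ∀ {K a b a' b'} → a ≅ b mod K → a' ≅ b' mod K → a + a' ≅ b + b' mod K
≅-+ {K} {b = b} {b' = b'} (multiple A a≡) (multiple A' a'≡) =
  multiple (A + A') (trans (cong₂ _+_ a≡ a'≡) (regroup b b' K A A'))
  where
  regroup : ∀ b b' K A A' → b + K * A + (b' + K * A') ≡ b + b' + K * (A + A')
  regroup = solve-∀

∣ℤ⇒≅ : ∀ K a b → b ≤ a → + K ∣ℤ (+ a -ℤ + b) → a ≅ b mod K
∣ℤ⇒≅ K a b b≤a K∣a-b with ∣⇒∣ᵤ K∣a-b
... | ℕ.divides q ∣a-b∣≡qK = multiple q (begin
  a                 ≡⟨ m+[n∸m]≡n b≤a ⟨
  b + (a ∸ b)       ≡⟨ cong (_+_ b) a∸b≡qK ⟩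
  b + q * K         ≡⟨ cong (_+_ b) (*-comm q K) ⟩
  b + K * q         ∎)
  where
  open ≡-Reasoning
  a∸b≡qK : a ∸ b ≡ q * K
  a∸b≡qK = trans (sym (cong ∣_∣ (trans (ℤ.[+m]-[+n]≡m⊖n a b) (ℤ.⊖-≥ b≤a)))) ∣a-b∣≡qK

-- fib is nondecreasing, so periodicity modulo K can be read in ℕ.
fib-mono : ∀ n d → fib n ≤ fib (n + d)
fib-mono n zero    = ≤-reflexive (cong fib (sym (+-identityʳ n)))
fib-mono n (suc d) = ≤-trans (fib-mono n d) (subst (λ m → fib (n + d) ≤ fib m) (sym (+-suc n d)) (step (n + d)))
  where
  step : ∀ m → fib m ≤ fib (suc m)
  step zero    = ≤-refl
  step (suc m) = m≤m+n (fib (suc m)) (fib m)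

n≤fib : ∀ n → n ≤ fib n
n≤fib zero             = z≤n
n≤fib (suc zero)       = ≤-refl
n≤fib (suc (suc n))    = ≤-trans (≤-reflexive (+-comm 1 (suc n))) (+-mono-≤ (n≤fib (suc n)) (1≤fib n))
  where
  1≤fib : ∀ n → 1 ≤ fib n
  1≤fib zero          = ≤-refl
  1≤fib (suc zero)    = ≤-refl
  1≤fib (suc (suc n)) = ≤-trans (1≤fib (suc n)) (m≤m+n _ _)

fib-period : ∀ K .{{_ : NonZero K}} → Σ ℕ λ P → 1 ≤ P × (∀ n → fib (n + P) ≅ fib n mod K)
fib-period K with fib-shiftPair K
... | d , 1≤d , i , shifted = d , 1≤d , λ n →
  ∣ℤ⇒≅ K (fib (n + d)) (fib n) (fib-mono n d) (proj₁ (shiftPair-from-0 K d (shiftPair-to-0 K d i shifted) n))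

pow-split : ∀ x m n → x * 2 ^ (m + n) ≡ x * 2 ^ m * 2 ^ n
pow-split x m n = trans (cong (x *_) (^-distribˡ-+-* 2 m n)) (sym (*-assoc x (2 ^ m) (2 ^ n)))

m<2^m : ∀ m → m < 2 ^ m
m<2^m zero    = s≤s z≤n
m<2^m (suc m) = ≤-trans (s≤s (m<2^m m)) (≤-trans (+-monoˡ-≤ (2 ^ m) (m^n>0 2 m)) (≤-reflexive (cong (_+_ (2 ^ m)) (sym (+-identityʳ (2 ^ m))))))

-- The numbers v g i = 1 (0^(2g) 11)^i in binary; S g is the length of one block.
S : ℕ → ℕ
S g = 2 + g * 2

v : ℕ → ℕ → ℕ
v g zero    = 1
v g (suc i) = v g i * 2 ^ S g + 3

-- Each v g (i + 1) = 1 + (1 + v g i · 4^g · 2)·2 ends in the digit 1 after a one of b.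
good-v : ∀ g i → Good (v g i)
good-v g zero    = good-1
good-v g (suc i) = subst Good (sym (shape (v g i) (2 ^ (g * 2))))
  (good-odd (1 + v g i * 2 ^ (g * 2) * 2) (trans (b-odd (v g i * 2 ^ (g * 2))) (trans (b-·4^ (v g i) g) (Good.b≡1 (good-v g i)))))
  where
  shape : ∀ x P → x * (2 * (2 * P)) + 3 ≡ 1 + (1 + x * P * 2) * 2
  shape = solve-∀

v-growth : ∀ g i → suc i ≤ v g i
v-growth g zero    = ≤-refl
v-growth g (suc i) = ≤-trans (s≤s (v-growth g i)) (subst (_≤ v g i * 2 ^ S g + 3) (+-comm (v g i) 1)
  (+-mono-≤ (m≤m*n (v g i) (2 ^ S g) {{>-nonZero (m^n>0 2 (S g))}}) (s≤s z≤n)))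

-- Appending one more block 0^(2g) 11 before the final e + 1 zeros adds the
-- ones of three quarters of a block of length 2^(e+3), namely fib (e + 2).
c-step : ∀ g i e → c (v g (suc i) * 2 ^ suc e) ≡ c (v g i * 2 ^ suc (S g + e)) + fib (2 + e)
c-step g i e = begin
  c ((V * 2 ^ S g + 3) * 2 ^ suc e)                        ≡⟨ cong c expand ⟩
  c (V * 2 ^ suc (S g + e) + 3 * 2 ^ suc e)                 ≡⟨ cnt-split 0 (V * 2 ^ suc (S g + e)) _ ⟩
  c (V * 2 ^ suc (S g + e)) + cnt (V * 2 ^ suc (S g + e)) (3 * 2 ^ suc e)
    ≡⟨ cong (λ a → c (V * 2 ^ suc (S g + e)) + cnt a (3 * 2 ^ suc e)) regroup ⟩
  c (V * 2 ^ suc (S g + e)) + cnt (V * 2 ^ (g * 2) * 2 ^ (3 + e)) (3 * 2 ^ suc e)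
    ≡⟨ cong (_+_ (c (V * 2 ^ suc (S g + e)))) (cnt-good (good-·4^ (good-v g i) g) (3 + e) _ three≤four) ⟩
  c (V * 2 ^ suc (S g + e)) + cnt (2 ^ (3 + e)) (3 * 2 ^ suc e)
    ≡⟨ cong (_+_ (c (V * 2 ^ suc (S g + e)))) (cnt-three-quarters e) ⟩
  c (V * 2 ^ suc (S g + e)) + fib (2 + e)                   ∎
  where
  open ≡-Reasoning
  V = v g i
  expand : (V * 2 ^ S g + 3) * 2 ^ suc e ≡ V * 2 ^ suc (S g + e) + 3 * 2 ^ suc e
  expand = trans (*-distribʳ-+ (2 ^ suc e) (V * 2 ^ S g) 3)
    (cong (_+ 3 * 2 ^ suc e) (trans (sym (pow-split V (S g) (suc e))) (cong (λ m → V * 2 ^ m) (+-suc (S g) e))))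
  regroup : V * 2 ^ suc (S g + e) ≡ V * 2 ^ (g * 2) * 2 ^ (3 + e)
  regroup = trans (cong (λ m → V * 2 ^ m) (exponent g e)) (pow-split V (g * 2) (3 + e))
    where
    exponent : ∀ g e → suc (2 + g * 2 + e) ≡ g * 2 + (3 + e)
    exponent = solve-∀
  three≤four : 3 * 2 ^ suc e ≤ 2 ^ (3 + e)
  three≤four = ≤-trans (*-monoˡ-≤ (2 ^ suc e) (n≤1+n 3)) (≤-reflexive (four (2 ^ e)))
    where
    four : ∀ P → 4 * (2 * P) ≡ 2 * (2 * (2 * P))
    four = solve-∀

-- Residue control: if P = g + 1 is a period of fib modulo K, then every block
-- 0^(2g) 11 contributes exactly 1 modulo K to the counting function.
module ResidueControl (K g : ℕ) (period : ∀ n → fib (n + suc g) ≅ fib n mod K) where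

  -- fib (n + P·w) ≡ fib n; in particular fib (S g · w) ≡ fib 0 = 1, as S g = 2P.
  fib-periodic : ∀ n w → fib (n + suc g * w) ≅ fib n mod K
  fib-periodic n zero    = subst (λ m → fib m ≅ fib n mod K) (sym (trans (cong (_+_ n) (*-zeroʳ g)) (+-identityʳ n))) (≅-refl _)
  fib-periodic n (suc w) = subst (λ m → fib m ≅ fib n mod K) (sym (regroup n g w))
    (≅-trans (period (n + suc g * w)) (fib-periodic n w))
    where
    regroup : ∀ n g w → n + suc g * suc w ≡ n + suc g * w + suc g
    regroup = solve-∀

  fib-S : ∀ w → fib (S g * w) ≅ 1 mod K
  fib-S w = subst (λ m → fib m ≅ 1 mod K) (regroup g w) (fib-periodic 0 (2 * w))
    where
    regroup : ∀ g w → 0 + suc g * (2 * w) ≡ (2 + g * 2) * w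
    regroup = solve-∀

  c-v : ∀ i e w → 2 + e ≡ S g * w → c (v g i * 2 ^ suc e) ≅ suc i mod K
  c-v zero e w 2+e≡Sw = subst (_≅ 1 mod K) (sym count) (fib-S w)
    where
    count : c (1 * 2 ^ suc e) ≡ fib (S g * w)
    count = trans (cong c (*-identityˡ (2 ^ suc e))) (trans (c-pow (suc e)) (cong fib 2+e≡Sw))
  c-v (suc i) e w 2+e≡Sw = subst (_≅ 2 + i mod K) (sym (c-step g i e))
    (subst (λ n → c (v g i * 2 ^ suc (S g + e)) + fib (2 + e) ≅ n mod K) (+-comm (suc i) 1)
      (≅-+ (c-v i (S g + e) (suc w) next) (subst (λ m → fib m ≅ 1 mod K) (sym 2+e≡Sw) (fib-S w))))
    where
    next : 2 + (S g + e) ≡ S g * suc w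
    next = trans (regroup (S g) e) (trans (cong (_+_ (S g)) 2+e≡Sw) (sym (*-suc (S g) w)))
      where
      regroup : ∀ s e → 2 + (s + e) ≡ s + (2 + e)
      regroup = solve-∀

appendOnes : ℕ → ℕ → ℕ
appendOnes x zero    = x
appendOnes x (suc j) = 1 + appendOnes x j * 2

b-appendOnes : ∀ x j → b (appendOnes x j) ≡ b x
b-appendOnes x zero    = refl
b-appendOnes x (suc j) = trans (b-odd (appendOnes x j)) (b-appendOnes x j)

appendOnes-next : ∀ x j → 1 + appendOnes x j ≡ (1 + x) * 2 ^ j
appendOnes-next x zero    = sym (*-identityʳ (1 + x))
appendOnes-next x (suc j) = trans (regroup (appendOnes x j)) (trans (cong (_* 2) (appendOnes-next x j)) (shift (1 + x) (2 ^ j)))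
  where
  regroup : ∀ a → 1 + (1 + a * 2) ≡ (1 + a) * 2
  regroup = solve-∀
  shift : ∀ y P → y * P * 2 ≡ y * (2 * P)
  shift = solve-∀

-- With t = j + 1 + q and t + 1 even, consider
--   A = V 00 0^t,  the window z = V 00 1^(j+1) 0^q of length 2^q,  and x = V 1 0^(t+1).
-- The window holds fib q ones, it ends at A + 2^t, and no one lies in [A + 2^t, x),
-- while b x = 1.
module GapAfterGoodPrefix (V : ℕ) (gV : Good V) (q j k : ℕ) (t+1-even : suc (suc j + q) ≡ k * 2) where

  t : ℕ
  t = suc j + q

  A z x : ℕ
  A = V * 2 ^ (2 + t)
  z = appendOnes (V * 4) (suc j) * 2 ^ q
  x = (1 + V * 2) * 2 ^ suc t

  A≡ : A ≡ V * 4 * 2 ^ t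
  A≡ = pow-split V 2 t

  window-end : z + 2 ^ q ≡ A + 2 ^ t
  window-end = begin
    appendOnes (V * 4) (suc j) * 2 ^ q + 2 ^ q   ≡⟨ +-comm _ (2 ^ q) ⟩
    (1 + appendOnes (V * 4) (suc j)) * 2 ^ q     ≡⟨ cong (_* 2 ^ q) (appendOnes-next (V * 4) (suc j)) ⟩
    (1 + V * 4) * 2 ^ suc j * 2 ^ q              ≡⟨ pow-split (1 + V * 4) (suc j) q ⟨
    (1 + V * 4) * 2 ^ t                          ≡⟨ +-comm (2 ^ t) _ ⟩
    V * 4 * 2 ^ t + 2 ^ t                        ≡⟨ cong (_+ 2 ^ t) A≡ ⟨
    A + 2 ^ t                                    ∎
    where open ≡-Reasoning

  gap-end : A + 2 ^ t + 2 ^ t ≡ x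
  gap-end = trans (cong (λ a → a + 2 ^ t + 2 ^ t) A≡) (shape V (2 ^ t))
    where
    shape : ∀ V P → V * 4 * P + P + P ≡ (1 + V * 2) * (2 * P)
    shape = solve-∀

  -- The block of the good prefix 4V holds fib t ones, the window fib q, and the
  -- block of the prefix 4V + 1 (= V 01) none.
  count-before-gap : c (A + 2 ^ t) ≡ c A + fib t
  count-before-gap = trans (cnt-split 0 A (2 ^ t)) (cong (_+_ (c A))
    (trans (cong (λ a → cnt a (2 ^ t)) A≡) (trans (cnt-good (good-·4^ gV 1) t (2 ^ t) ≤-refl) (cnt-pow t))))

  count-window : c (z + 2 ^ q) ≡ c z + fib q
  count-window = trans (cnt-split 0 z (2 ^ q)) (cong (_+_ (c z))
    (trans (cnt-good goodW q (2 ^ q) ≤-refl) (cnt-pow q)))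
    where
    goodW : Good (appendOnes (V * 4) (suc j))
    goodW = good-odd (appendOnes (V * 4) j) (trans (b-appendOnes (V * 4) j) (trans (b-4n V) (Good.b≡1 gV)))

  count-gap : c x ≡ c (A + 2 ^ t)
  count-gap = begin
    c x                                        ≡⟨ cong c gap-end ⟨
    c (A + 2 ^ t + 2 ^ t)                      ≡⟨ cnt-split 0 (A + 2 ^ t) (2 ^ t) ⟩
    c (A + 2 ^ t) + cnt (A + 2 ^ t) (2 ^ t)    ≡⟨ cong (λ a → c (A + 2 ^ t) + cnt a (2 ^ t)) start ⟩
    c (A + 2 ^ t) + cnt ((1 + V * 4) * 2 ^ t) (2 ^ t)
      ≡⟨ cong (_+_ (c (A + 2 ^ t))) (cnt-zero-prefix (1 + V * 4) b0 b00 t) ⟩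
    c (A + 2 ^ t) + 0                          ≡⟨ +-identityʳ _ ⟩
    c (A + 2 ^ t)                              ∎
    where
    open ≡-Reasoning
    start : A + 2 ^ t ≡ (1 + V * 4) * 2 ^ t
    start = trans (cong (_+ 2 ^ t) A≡) (+-comm _ (2 ^ t))
    b0 : b (1 + V * 4) ≡ 0
    b0 = trans (cong b (shape V)) (trans (b-odd (V * 2)) (Good.b2≡0 gV))
      where
      shape : ∀ V → 1 + V * 4 ≡ 1 + V * 2 * 2
      shape = solve-∀
    b00 : b ((1 + V * 4) * 2) ≡ 0
    b00 = trans (cong b (shape V)) (b-4n+2 (V * 2))
      where
      shape : ∀ V → (1 + V * 4) * 2 ≡ 2 + V * 2 * 4
      shape = solve-∀

  b-x : b x ≡ 1
  b-x = trans (cong (λ m → b ((1 + V * 2) * 2 ^ m)) t+1-even)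
    (trans (b-·4^ (1 + V * 2) k) (trans (b-odd V) (Good.b≡1 gV)))

-- The enumeration l of the ones of b is the inverse of the counting function:
-- l n < x exactly when n < c x.
module Enumeration (l : ℕ → ℕ) (mono : ∀ {a b} → a < b → l a < l b)
                   (onesOfB : ∀ m → (b m ≡ 1) ⇔ (∃ λ n → l n ≡ m)) where

  b-l : ∀ n → b (l n) ≡ 1
  b-l n = Equivalence.from (onesOfB (l n)) (n , refl)

  Separates : ℕ → Set
  Separates x = (∀ n → l n < x → n < c x) × (∀ n → n < c x → l n < x)

  below-all : ∀ x n → (∀ k → l k < l n → k < c x) → n ≤ c x
  below-all x zero    _     = z≤n
  below-all x (suc k) below = below k (mono (n<1+n k))

  -- Passing from x to x + 1: when b x = 1, the new index c x belongs to x itself.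
  separates-suc : ∀ x → Separates x → Separates (suc x)
  separates-suc x (to , from) = to′ , from′
    where
    to′ : ∀ n → l n < suc x → n < c (suc x)
    to′ n ln<1+x with m≤n⇒m<n∨m≡n (≤-pred ln<1+x)
    ... | inj₁ ln<x  = ≤-trans (to n ln<x) (m≤m+n (c x) (b x))
    ... | inj₂ refl  = subst (n <_) (trans (+-comm 1 (c (l n))) (cong (_+_ (c (l n))) (sym (b-l n))))
                             (s≤s (below-all (l n) n to))
    from′ : ∀ n → n < c (suc x) → l n < suc x
    from′ n n<c[1+x] with n <? c x
    ... | yes n<cx = m<n⇒m<1+n (from n n<cx)
    ... | no  n≮cx = s≤s (≤-reflexive (trans (cong l (sym index≡n)) (proj₂ preimage)))
      where
      bx≡1 : b x ≡ 1
      bx≡1 with b∈01 x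
      ... | inj₂ bx≡1 = bx≡1
      ... | inj₁ bx≡0 = ⊥-elim (n≮cx (subst (n <_) (trans (cong (_+_ (c x)) bx≡0) (+-identityʳ (c x))) n<c[1+x]))
      n≡cx : n ≡ c x
      n≡cx = ≤-antisym (≤-pred (subst (n <_) (trans (cong (_+_ (c x)) bx≡1) (+-comm (c x) 1)) n<c[1+x])) (≮⇒≥ n≮cx)
      preimage : ∃ λ m → l m ≡ x
      preimage = Equivalence.to (onesOfB x) bx≡1
      index≡n : proj₁ preimage ≡ n
      index≡n with <-cmp (proj₁ preimage) n
      ... | tri< m<n _ _ = ⊥-elim (<-irrefl (proj₂ preimage) (from _ (subst (proj₁ preimage <_) n≡cx m<n)))
      ... | tri≈ _ m≡n _ = m≡n
      ... | tri> _ _ n<m = ⊥-elim (<-irrefl n≡cx (to n (subst (l n <_) (proj₂ preimage) (mono n<m))))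

  separates : ∀ x → Separates x
  separates zero    = (λ _ ()) , (λ _ ())
  separates (suc x) = separates-suc x (separates x)

  in-window : ∀ z w n → c z ≤ n → n < c (z + w) → z ≤ l n × l n < z + w
  in-window z w n cz≤n n<c[z+w] =
    ≮⇒≥ (λ ln<z → <⇒≱ (proj₁ (separates z) n ln<z) cz≤n) , proj₂ (separates (z + w)) n n<c[z+w]

  l-c : ∀ x → b x ≡ 1 → l (c x) ≡ x
  l-c x bx≡1 = ≤-antisym (≤-pred (proj₂ (separates (suc x)) (c x) cx<c[1+x]))
                         (≮⇒≥ (λ l<x → <-irrefl refl (proj₁ (separates x) (c x) l<x)))
    where
    cx<c[1+x] : c x < c (suc x)
    cx<c[1+x] = subst (c x <_) (sym (trans (cong (_+_ (c x)) bx≡1) (+-comm (c x) 1))) ≤-refl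

module Gaps (l : ℕ → ℕ) (mono : ∀ {a b} → a < b → l a < l b)
            (onesOfB : ∀ m → (b m ≡ 1) ⇔ (∃ λ n → l n ≡ m)) where
  open Enumeration l mono onesOfB

  record GapConfiguration (K s R : ℕ) : Set where
    field
      n z w Δ : ℕ
      window  : ∀ j → j < s → z ≤ l (K * n + j) × l (K * n + j) < z + w
      jump    : l (K * n + s) ≡ z + Δ
      narrow  : R * w < Δ
      far     : R * (w + Δ) < z

  -- The
  -- window has length 2^K' (it holds fib K' ≥ K' ≥ s ones) and is followed by an
  -- empty stretch of length 2^t; the prefix v g c' makes c x ≡ s modulo K.
  module Construction (K' s R g : ℕ) (s<K : s < suc K')
                      (period : ∀ n → fib (n + suc g) ≅ fib n mod suc K') where
    open ResidueControl (suc K') g period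

    K j t k c' : ℕ
    K  = suc K'
    j  = g * (1 + K + R) * 2 + K' + R * 2
    t  = suc j + K'
    k  = K + R + g * (1 + K + R)
    c' = K' * (1 + fib t) + s + K * R

    t+1-even : suc t ≡ k * 2
    t+1-even = arith g K' R
      where
      arith : ∀ g K' R → suc (suc (g * (2 + K' + R) * 2 + K' + R * 2) + K')
                       ≡ (suc K' + R + g * (2 + K' + R)) * 2
      arith = solve-∀

    t+3-multiple : 2 + suc t ≡ S g * suc (K + R)
    t+3-multiple = arith g K' R
      where
      arith : ∀ g K' R → 2 + suc (suc (g * (2 + K' + R) * 2 + K' + R * 2) + K')
                       ≡ (2 + g * 2) * suc (suc K' + R)
      arith = solve-∀

    open GapAfterGoodPrefix (v g c') (good-v g c') K' j k t+1-even hiding (t)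

    -- The choice of c' places x, the first one after the gap, at index K n + s.
    residue : c A ≅ suc c' mod K
    residue = c-v c' (suc t) (suc (K + R)) t+3-multiple

    n : ℕ
    n = 1 + fib t + R + _≅_mod_.quotient residue

    count-x : c x ≡ K * n + s
    count-x = begin
      c x                                  ≡⟨ trans count-gap count-before-gap ⟩
      c A + fib t                          ≡⟨ cong (_+ fib t) (_≅_mod_.equation residue) ⟩
      suc c' + K * Q + fib t               ≡⟨ arith K' s R Q (fib t) ⟩
      K * n + s                            ∎
      where
      open ≡-Reasoning
      Q = _≅_mod_.quotient residue
      arith : ∀ K' s R Q f → suc (K' * (1 + f) + s + suc K' * R) + suc K' * Q + f
                           ≡ suc K' * (1 + f + R + Q) + s
      arith = solve-∀

    -- Hence the window [z, z + 2^K') contains the indices K n, …, K n + s - 1.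
    count-window-end : c (z + 2 ^ K') ≡ K * n + s
    count-window-end = trans (cong c window-end) (trans (sym count-gap) count-x)

    count-z : c z ≤ K * n
    count-z = +-cancelʳ-≤ s (c z) (K * n) (begin
      c z + s           ≤⟨ +-monoʳ-≤ (c z) (≤-trans (≤-pred s<K) (n≤fib K')) ⟩
      c z + fib K'      ≡⟨ count-window ⟨
      c (z + 2 ^ K')    ≡⟨ count-window-end ⟩
      K * n + s         ∎)
      where open ≤-Reasoning

    window : ∀ i → i < s → z ≤ l (K * n + i) × l (K * n + i) < z + 2 ^ K'
    window i i<s = in-window z (2 ^ K') (K * n + i) (≤-trans count-z (m≤m+n (K * n) i))
      (subst (K * n + i <_) (sym count-window-end) (+-monoʳ-< (K * n) i<s))

    jump : l (K * n + s) ≡ z + (2 ^ K' + 2 ^ t)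
    jump = trans (cong l (sym count-x)) (trans (l-c x b-x)
      (sym (trans (sym (+-assoc z (2 ^ K') (2 ^ t))) (trans (cong (_+ 2 ^ t) window-end) gap-end))))

    -- The size conditions: the gap 2^t dwarfs R·2^K', and z ≥ A dwarfs R·2^(t+1).
    narrow : R * 2 ^ K' < 2 ^ K' + 2 ^ t
    narrow = begin-strict
      R * 2 ^ K'              <⟨ *-monoˡ-< (2 ^ K') {{>-nonZero (m^n>0 2 K')}} R<2^[1+j] ⟩
      2 ^ suc j * 2 ^ K'      ≡⟨ ^-distribˡ-+-* 2 (suc j) K' ⟨
      2 ^ t                   ≤⟨ m≤n+m (2 ^ t) (2 ^ K') ⟩
      2 ^ K' + 2 ^ t          ∎
      where
      open ≤-Reasoning
      R≤j : R ≤ j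
      R≤j = ≤-trans (m≤m*n R 2) (m≤n+m (R * 2) (g * (1 + K + R) * 2 + K'))
      R<2^[1+j] : R < 2 ^ suc j
      R<2^[1+j] = ≤-<-trans R≤j (<-≤-trans (m<2^m j) (^-monoʳ-≤ 2 (n≤1+n j)))

    far : R * (2 ^ K' + (2 ^ K' + 2 ^ t)) < z
    far = begin-strict
      R * (2 ^ K' + (2 ^ K' + 2 ^ t))   ≤⟨ *-monoʳ-≤ R window+gap ⟩
      R * (2 * 2 ^ t)                  <⟨ *-monoˡ-< (2 * 2 ^ t) {{>-nonZero (m^n>0 2 (suc t))}} R<V ⟩
      v g c' * 2 ^ suc t               ≤⟨ *-monoʳ-≤ (v g c') (^-monoʳ-≤ 2 (n≤1+n (suc t))) ⟩
      A                                ≤⟨ A≤z ⟩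
      z                                ∎
      where
      open ≤-Reasoning
      R<V : R < v g c'
      R<V = <-≤-trans (s≤s (≤-trans (m≤n*m R K) (m≤n+m (K * R) (K' * (1 + fib t) + s)))) (v-growth g c')
      window+gap : 2 ^ K' + (2 ^ K' + 2 ^ t) ≤ 2 * 2 ^ t
      window+gap = begin
        2 ^ K' + (2 ^ K' + 2 ^ t)   ≡⟨ regroup (2 ^ K') (2 ^ t) ⟩
        2 * 2 ^ K' + 2 ^ t          ≤⟨ +-monoˡ-≤ (2 ^ t) (^-monoʳ-≤ 2 (s≤s (m≤n+m K' j))) ⟩
        2 ^ t + 2 ^ t               ≡⟨ regroup′ (2 ^ t) ⟩
        2 * 2 ^ t                   ∎
        where
        regroup : ∀ P Q → P + (P + Q) ≡ 2 * P + Q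
        regroup = solve-∀
        regroup′ : ∀ Q → Q + Q ≡ 2 * Q
        regroup′ = solve-∀
      A≤z : A ≤ z
      A≤z = +-cancelʳ-≤ (2 ^ t) A z (begin
        A + 2 ^ t                   ≡⟨ window-end ⟨
        z + 2 ^ K'                  ≤⟨ +-monoʳ-≤ z (^-monoʳ-≤ 2 (m≤n+m K' (suc j))) ⟩
        z + 2 ^ t                   ∎)

    configuration : GapConfiguration K s R
    configuration = record
      { n = n ; z = z ; w = 2 ^ K' ; Δ = 2 ^ K' + 2 ^ t
      ; window = window ; jump = jump ; narrow = narrow ; far = far }

  gapConfiguration : ∀ K s → s < K → ∀ R → GapConfiguration K s R
  gapConfiguration (suc K') s s<K R = fromPeriod (fib-period (suc K'))
    where
    fromPeriod : Σ ℕ (λ P → 1 ≤ P × (∀ n → fib (n + P) ≅ fib n mod suc K')) → GapConfiguration (suc K') s R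
    fromPeriod (suc g , _ , period) = Construction.configuration K' s R g s<K period

-- Eliminating the first coordinate with the pivot row p: from a relation d'
-- among the reduced rows a·u (p↑i) − u (p↑i) 0 · u p, build one among the u i.
eliminate : ∀ {m n} (u : Fin (suc n) → Fin m → ℤ) (p : Fin (suc n)) (z₀ : Fin m) (d' : Fin n → ℤ) →
  let a = u p z₀
      d = insertAt (λ i → a *ℤ d' i) p (-ℤ sum (λ i → d' i *ℤ u (punchIn p i) z₀))
  in ∀ r → sum (λ i → d i *ℤ u i r)
         ≡ sum (λ i → d' i *ℤ (a *ℤ u (punchIn p i) r -ℤ u (punchIn p i) z₀ *ℤ u p r))
eliminate u p z₀ d' r = begin
  sum (λ i → d i *ℤ u i r)                                   ≡⟨ sum-remove {i = p} (λ i → d i *ℤ u i r) ⟩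
  d p *ℤ u p r +ℤ sum (λ i → d (punchIn p i) *ℤ u (punchIn p i) r)
    ≡⟨ cong₂ _+ℤ_ (cong (_*ℤ u p r) (insertAt-lookup _ p _))
                  (sum-cong-≗ (λ i → cong (_*ℤ u (punchIn p i) r) (insertAt-punchIn _ p _ i))) ⟩
  -ℤ sum f *ℤ u p r +ℤ sum (λ i → a *ℤ d' i *ℤ u (punchIn p i) r)
    ≡⟨ cong (_+ℤ sum (λ i → a *ℤ d' i *ℤ u (punchIn p i) r))
            (trans (neg-swap (sum f) (u p r)) (*-distribʳ-sum (-ℤ u p r) f)) ⟩
  sum (λ i → f i *ℤ -ℤ u p r) +ℤ sum (λ i → a *ℤ d' i *ℤ u (punchIn p i) r)
    ≡⟨ ∑-distrib-+ (λ i → f i *ℤ -ℤ u p r) _ ⟨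
  sum (λ i → f i *ℤ -ℤ u p r +ℤ a *ℤ d' i *ℤ u (punchIn p i) r)
    ≡⟨ sum-cong-≗ (λ i → pointwise (d' i) (u (punchIn p i) z₀) (u p r) a (u (punchIn p i) r)) ⟩
  sum (λ i → d' i *ℤ (a *ℤ u (punchIn p i) r -ℤ u (punchIn p i) z₀ *ℤ u p r)) ∎
  where
  open ≡-Reasoning
  a = u p z₀
  f : Fin _ → ℤ
  f i = d' i *ℤ u (punchIn p i) z₀
  d = insertAt (λ i → a *ℤ d' i) p (-ℤ sum f)
  neg-swap : ∀ s y → -ℤ s *ℤ y ≡ s *ℤ -ℤ y
  neg-swap = solveℤ-∀
  pointwise : ∀ e c y a x → e *ℤ c *ℤ -ℤ y +ℤ a *ℤ e *ℤ x ≡ e *ℤ (a *ℤ x -ℤ c *ℤ y)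
  pointwise = solveℤ-∀

Relation : ∀ {m n} → (Fin n → Fin m → ℤ) → Set
Relation {m} {n} u = Σ (Fin n → ℤ) λ d → (∃ λ i → d i ≢ + 0) × (∀ r → sum (λ i → d i *ℤ u i r) ≡ + 0)

-- More than m integer vectors of length m are linearly dependent over ℤ
-- (Gaussian elimination on the first coordinate, without division).
linearDependence : ∀ m n → m < n → (u : Fin n → Fin m → ℤ) → Relation u
linearDependence zero    (suc n) _         u = (λ _ → + 1) , (Fin.zero , λ ()) , λ ()
linearDependence (suc m) (suc n) (s≤s m<n) u with Fin.any? (λ i → ¬? (u i Fin.zero ℤ.≟ + 0))
... | no noPivot = d , nonzero , relation
  where
  tails = linearDependence m (suc n) (m<n⇒m<1+n m<n) (λ i r → u i (Fin.suc r))
  d = proj₁ tails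
  nonzero = proj₁ (proj₂ tails)
  column0 : ∀ i → u i Fin.zero ≡ + 0
  column0 i = decidable-stable (u i Fin.zero ℤ.≟ + 0) (λ u≢0 → noPivot (i , u≢0))
  relation : ∀ r → sum (λ i → d i *ℤ u i r) ≡ + 0
  relation Fin.zero    = trans (sum-cong-≗ (λ i → trans (cong (_*ℤ_ (d i)) (column0 i)) (ℤ.*-zeroʳ (d i))))
                               (sum-replicate-zero (suc n))
  relation (Fin.suc r) = proj₂ (proj₂ tails) r
... | yes (p , pivot≢0) = d , (punchIn p i₀ , nonzero) , relation
  where
  a = u p Fin.zero
  reduced = linearDependence m n m<n (λ i r → a *ℤ u (punchIn p i) (Fin.suc r) -ℤ u (punchIn p i) Fin.zero *ℤ u p (Fin.suc r))
  d' = proj₁ reduced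
  i₀ = proj₁ (proj₁ (proj₂ reduced))
  d = insertAt (λ i → a *ℤ d' i) p (-ℤ sum (λ i → d' i *ℤ u (punchIn p i) Fin.zero))
  nonzero : d (punchIn p i₀) ≢ + 0
  nonzero d≡0 with ℤ.i*j≡0⇒i≡0∨j≡0 a (trans (sym (insertAt-punchIn _ p _ i₀)) d≡0)
  ... | inj₁ a≡0  = pivot≢0 a≡0
  ... | inj₂ d'≡0 = proj₂ (proj₁ (proj₂ reduced)) d'≡0
  relation : ∀ r → sum (λ i → d i *ℤ u i r) ≡ + 0
  relation Fin.zero    = trans (eliminate u p Fin.zero d' Fin.zero)
    (trans (sum-cong-≗ (λ i → cancel (d' i) a (u (punchIn p i) Fin.zero))) (sum-replicate-zero n))
    where
    cancel : ∀ e a x → e *ℤ (a *ℤ x -ℤ x *ℤ a) ≡ + 0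
    cancel = solveℤ-∀
  relation (Fin.suc r) = trans (eliminate u p Fin.zero d' (Fin.suc r)) (proj₂ (proj₂ reduced) r)

sumℤ : ℕ → (ℕ → ℤ) → ℤ
sumℤ zero    f = + 0
sumℤ (suc n) f = sumℤ n f +ℤ f n

sumℕ : ℕ → (ℕ → ℕ) → ℕ
sumℕ zero    f = 0
sumℕ (suc n) f = sumℕ n f + f n

sum-toℕ : ∀ n (f : ℕ → ℤ) → sum (λ (i : Fin n) → f (toℕ i)) ≡ sumℤ n f
sum-toℕ zero    f = refl
sum-toℕ (suc n) f = begin
  sum {suc n} (λ i → f (toℕ i))                             ≡⟨ sum-init-last {n} (λ i → f (toℕ i)) ⟩
  sum {n} (λ i → f (toℕ (inject₁ i))) +ℤ f (toℕ (fromℕ n))  ≡⟨ cong₂ _+ℤ_ reindex (cong f (Fin.toℕ-fromℕ n)) ⟩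
  sum {n} (λ i → f (toℕ i)) +ℤ f n                          ≡⟨ cong (_+ℤ f n) (sum-toℕ n f) ⟩
  sumℤ n f +ℤ f n                                            ∎
  where
  open ≡-Reasoning
  reindex : sum {n} (λ i → f (toℕ (inject₁ i))) ≡ sum {n} (λ i → f (toℕ i))
  reindex = sum-cong-≗ {n} {λ i → f (toℕ (inject₁ i))} {λ i → f (toℕ i)} (λ i → cong f (Fin.toℕ-inject₁ i))

sumℤ-truncate : ∀ n s (f : ℕ → ℤ) → s < n → (∀ j → s < j → j < n → f j ≡ + 0) → sumℤ n f ≡ sumℤ (suc s) f
sumℤ-truncate (suc n) s f s<1+n vanish with m≤n⇒m<n∨m≡n (≤-pred s<1+n)
... | inj₂ refl = refl
... | inj₁ s<n  = trans (cong (_+ℤ_ (sumℤ n f)) (vanish n s<n ≤-refl))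
  (trans (ℤ.+-identityʳ _) (sumℤ-truncate n s f s<n (λ j s<j j<n → vanish j s<j (m<n⇒m<1+n j<n))))

weighted-bound : ∀ n (d : ℕ → ℤ) (e : ℕ → ℕ) B → (∀ j → j < n → e j ≤ B) →
                 ∣ sumℤ n (λ j → d j *ℤ + e j) ∣ ≤ sumℕ n (λ j → ∣ d j ∣) * B
weighted-bound zero    d e B _ = z≤n
weighted-bound (suc n) d e B e≤B = begin
  ∣ sumℤ n (λ j → d j *ℤ + e j) +ℤ d n *ℤ + e n ∣                ≤⟨ ℤ.∣i+j∣≤∣i∣+∣j∣ (sumℤ n (λ j → d j *ℤ + e j)) (d n *ℤ + e n) ⟩
  ∣ sumℤ n (λ j → d j *ℤ + e j) ∣ + ∣ d n *ℤ + e n ∣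
    ≤⟨ +-mono-≤ (weighted-bound n d e B (λ j j<n → e≤B j (m<n⇒m<1+n j<n)))
                (≤-trans (≤-reflexive (ℤ.∣i*j∣≡∣i∣*∣j∣ (d n) (+ e n))) (*-monoʳ-≤ ∣ d n ∣ (e≤B n ≤-refl))) ⟩
  sumℕ n (λ j → ∣ d j ∣) * B + ∣ d n ∣ * B                       ≡⟨ *-distribʳ-+ B (sumℕ n _) ∣ d n ∣ ⟨
  sumℕ (suc n) (λ j → ∣ d j ∣) * B                               ∎
  where open ≤-Reasoning

sumℤ-offset : ∀ n (d : ℕ → ℤ) (e : ℕ → ℕ) z →
  sumℤ n (λ j → d j *ℤ + (z + e j)) ≡ sumℤ n d *ℤ + z +ℤ sumℤ n (λ j → d j *ℤ + e j)
sumℤ-offset zero    d e z = refl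
sumℤ-offset (suc n) d e z = trans
  (cong₂ _+ℤ_ (sumℤ-offset n d e z) (cong (_*ℤ_ (d n)) (ℤ.pos-+ z (e n))))
  (regroup (sumℤ n d) (+ z) (sumℤ n (λ j → d j *ℤ + e j)) (d n) (+ e n))
  where
  regroup : ∀ D Z E dn en → (D *ℤ Z +ℤ E) +ℤ dn *ℤ (Z +ℤ en) ≡ (D +ℤ dn) *ℤ Z +ℤ (E +ℤ dn *ℤ en)
  regroup = solveℤ-∀

sumℤ-cong : ∀ n {f g : ℕ → ℤ} → (∀ j → j < n → f j ≡ g j) → sumℤ n f ≡ sumℤ n g
sumℤ-cong zero    same = refl
sumℤ-cong (suc n) same = cong₂ _+ℤ_ (sumℤ-cong n (λ j j<n → same j (m<n⇒m<1+n j<n))) (same n ≤-refl)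

∣∣-opposite : ∀ x y → x +ℤ y ≡ + 0 → ∣ x ∣ ≡ ∣ y ∣
∣∣-opposite x y x+y≡0 = trans (cong ∣_∣ x≡-y) (ℤ.∣-i∣≡∣i∣ y)
  where
  x≡-y : x ≡ -ℤ y
  x≡-y = trans (split x y) (trans (cong (_-ℤ y) x+y≡0) (ℤ.+-identityˡ (-ℤ y)))
    where
    split : ∀ x y → x ≡ (x +ℤ y) -ℤ y
    split = solveℤ-∀

≤∣*∣ : ∀ x n → x ≢ + 0 → n ≤ ∣ x *ℤ + n ∣
≤∣*∣ x n x≢0 = ≤-trans (m≤n*m n ∣ x ∣ {{≢-nonZero (λ ∣x∣≡0 → x≢0 (ℤ.∣i∣≡0⇒i≡0 ∣x∣≡0))}})
                       (≤-reflexive (sym (ℤ.∣i*j∣≡∣i∣*∣j∣ x (+ n))))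

-- Let R = Σ_{j≤s} |d j| and d s ≠ 0.  A relation
-- Σ_{j≤s} d j · a j = 0 is impossible if a 0, …, a (s-1) lie in a window
-- [z, z + w) and a s = z + Δ, where R·w < Δ and R·(w + Δ) < z.  Writing
-- a j = z + e j, the relation reads D·z + E = 0 with D = Σ d j, E = Σ d j · e j;
-- if D ≠ 0 then |E| ≥ z is too large, and if D = 0 then the term d s · Δ
-- cannot be cancelled by the other, small, terms.
gap-contradiction : ∀ s (d : ℕ → ℤ) (a : ℕ → ℕ) z w Δ → d s ≢ + 0 →
  (∀ j → j < s → z ≤ a j × a j < z + w) → a s ≡ z + Δ →
  sumℕ (suc s) (λ j → ∣ d j ∣) * w < Δ → sumℕ (suc s) (λ j → ∣ d j ∣) * (w + Δ) < z →
  sumℤ (suc s) (λ j → d j *ℤ + a j) ≢ + 0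
gap-contradiction s d a z w Δ ds≢0 window as≡z+Δ small far relation = cases (D ℤ.≟ + 0)
  where
  R = sumℕ (suc s) (λ j → ∣ d j ∣)
  e : ℕ → ℕ
  e j = a j ∸ z
  offset : ∀ j → j < suc s → a j ≡ z + e j
  offset j j≤s with m≤n⇒m<n∨m≡n (≤-pred j≤s)
  ... | inj₁ j<s  = sym (m+[n∸m]≡n (proj₁ (window j j<s)))
  ... | inj₂ refl = sym (m+[n∸m]≡n (subst (z ≤_) (sym as≡z+Δ) (m≤m+n z Δ)))
  e-last : e s ≡ Δ
  e-last = trans (cong (_∸ z) as≡z+Δ) (m+n∸m≡n z Δ)
  e<w : ∀ j → j < s → e j < w
  e<w j j<s = +-cancelˡ-< z (e j) w (subst (_< z + w) (offset j (m<n⇒m<1+n j<s)) (proj₂ (window j j<s)))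
  e≤w+Δ : ∀ j → j < suc s → e j ≤ w + Δ
  e≤w+Δ j j≤s with m≤n⇒m<n∨m≡n (≤-pred j≤s)
  ... | inj₁ j<s  = ≤-trans (<⇒≤ (e<w j j<s)) (m≤m+n w Δ)
  ... | inj₂ refl = ≤-trans (≤-reflexive e-last) (m≤n+m Δ w)
  D E : ℤ
  D = sumℤ (suc s) d
  E = sumℤ (suc s) (λ j → d j *ℤ + e j)
  offsetRelation : D *ℤ + z +ℤ E ≡ + 0
  offsetRelation = trans (sym (sumℤ-offset (suc s) d e z))
    (trans (sumℤ-cong (suc s) (λ j j≤s → cong (λ x → d j *ℤ + x) (sym (offset j j≤s)))) relation)
  cases : Dec (D ≡ + 0) → ⊥
  cases (no D≢0) = <-irrefl refl (begin-strict
    z                   ≤⟨ ≤∣*∣ D z D≢0 ⟩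
    ∣ D *ℤ + z ∣        ≡⟨ ∣∣-opposite (D *ℤ + z) E offsetRelation ⟩
    ∣ E ∣               ≤⟨ weighted-bound (suc s) d e (w + Δ) e≤w+Δ ⟩
    R * (w + Δ)         <⟨ far ⟩
    z                   ∎)
    where open ≤-Reasoning
  cases (yes D≡0) = <-irrefl refl (begin-strict
    Δ                                      ≤⟨ ≤∣*∣ (d s) Δ ds≢0 ⟩
    ∣ d s *ℤ + Δ ∣                         ≡⟨ ∣∣-opposite (sumℤ s (λ j → d j *ℤ + e j)) (d s *ℤ + Δ) rest+last≡0 ⟨
    ∣ sumℤ s (λ j → d j *ℤ + e j) ∣        ≤⟨ weighted-bound s d e w (λ j j<s → <⇒≤ (e<w j j<s)) ⟩
    sumℕ s (λ j → ∣ d j ∣) * w             ≤⟨ *-monoˡ-≤ w (m≤m+n (sumℕ s (λ j → ∣ d j ∣)) ∣ d s ∣) ⟩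
    R * w                                  <⟨ small ⟩
    Δ                                      ∎)
    where
    open ≤-Reasoning
    E≡0 : E ≡ + 0
    E≡0 = trans (sym (trans (cong (λ D → D *ℤ + z +ℤ E) D≡0) (ℤ.+-identityˡ E))) offsetRelation
    rest+last≡0 : sumℤ s (λ j → d j *ℤ + e j) +ℤ d s *ℤ + Δ ≡ + 0
    rest+last≡0 = trans (cong (λ x → sumℤ s (λ j → d j *ℤ + e j) +ℤ d s *ℤ + x) (sym e-last)) E≡0

Σℤ≡sum : ∀ m (f : Fin m → ℤ) → Σℤ m f ≡ sum f
Σℤ≡sum zero    f = refl
Σℤ≡sum (suc m) f = cong (_+ℤ_ (f Fin.zero)) (Σℤ≡sum m (λ r → f (Fin.suc r)))

-- If the k-kernel of u is spanned by m sequences, then the K = k^(m+1) > m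
-- sequences n ↦ u (K n + j), j < K, satisfy a common nontrivial relation.
regular⇒relation : ∀ k u → 2 ≤ k → IsRegular k u →
  Σ ℕ λ K → Σ (Fin K → ℤ) λ d → (∃ λ i → d i ≢ + 0) × (∀ n → sum (λ i → d i *ℤ u (K * n + toℕ i)) ≡ + 0)
regular⇒relation k u 2≤k (m , gens , spans) = K , d , nonzero , vanishes
  where
  K = k ^ suc m
  m<K : m < K
  m<K = <-≤-trans (<-trans (m<2^m m) (^-monoʳ-< 2 (s≤s (s≤s z≤n)) (n<1+n m))) (^-monoˡ-≤ (suc m) 2≤k)
  coeffs : Fin K → Fin m → ℤ
  coeffs i = proj₁ (spans (suc m) (toℕ i) (Fin.toℕ<n i))
  expansion : ∀ i n → u (K * n + toℕ i) ≡ sum (λ r → coeffs i r *ℤ gens r n)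
  expansion i n = trans (proj₂ (spans (suc m) (toℕ i) (Fin.toℕ<n i)) n) (Σℤ≡sum m _)
  dependence = linearDependence m K m<K coeffs
  d = proj₁ dependence
  nonzero = proj₁ (proj₂ dependence)
  vanishes : ∀ n → sum (λ i → d i *ℤ u (K * n + toℕ i)) ≡ + 0
  vanishes n = begin
    sum (λ i → d i *ℤ u (K * n + toℕ i))                        ≡⟨ sum-cong-≗ (λ i → cong (_*ℤ_ (d i)) (expansion i n)) ⟩
    sum (λ i → d i *ℤ sum (λ r → coeffs i r *ℤ gens r n))       ≡⟨ sum-cong-≗ (λ i → *-distribˡ-sum (d i) (λ r → coeffs i r *ℤ gens r n)) ⟩
    sum (λ i → sum (λ r → d i *ℤ (coeffs i r *ℤ gens r n)))     ≡⟨ ∑-comm (λ i r → d i *ℤ (coeffs i r *ℤ gens r n)) ⟩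
    sum (λ r → sum (λ i → d i *ℤ (coeffs i r *ℤ gens r n)))     ≡⟨ sum-cong-≗ (λ r → column r) ⟩
    sum {m} (λ r → + 0)                                         ≡⟨ sum-replicate-zero m ⟩
    + 0                                                         ∎
    where
    open ≡-Reasoning
    column : ∀ r → sum (λ i → d i *ℤ (coeffs i r *ℤ gens r n)) ≡ + 0
    column r = begin
      sum (λ i → d i *ℤ (coeffs i r *ℤ gens r n))   ≡⟨ sum-cong-≗ (λ i → sym (ℤ.*-assoc (d i) (coeffs i r) (gens r n))) ⟩
      sum (λ i → d i *ℤ coeffs i r *ℤ gens r n)     ≡⟨ *-distribʳ-sum (gens r n) (λ i → d i *ℤ coeffs i r) ⟨
      sum (λ i → d i *ℤ coeffs i r) *ℤ gens r n     ≡⟨ cong (_*ℤ gens r n) (proj₂ (proj₂ dependence) r) ⟩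
      + 0 *ℤ gens r n                               ≡⟨ ℤ.*-zeroˡ (gens r n) ⟩
      + 0                                           ∎

extend : ∀ {K} → (Fin K → ℤ) → ℕ → ℤ
extend {K} d j with j <? K
... | yes j<K = d (fromℕ< j<K)
... | no  _   = + 0

extend-toℕ : ∀ {K} (d : Fin K → ℤ) i → extend d (toℕ i) ≡ d i
extend-toℕ {K} d i with toℕ i <? K
... | yes i<K = cong d (Fin.fromℕ<-toℕ i i<K)
... | no  i≮K = ⊥-elim (i≮K (Fin.toℕ<n i))

lastNonzero : ∀ K (f : ℕ → ℤ) → (∃ λ j → j < K × f j ≢ + 0) →
              Σ ℕ λ s → s < K × f s ≢ + 0 × (∀ j → s < j → j < K → f j ≡ + 0)
lastNonzero (suc K) f (j , j<1+K , fj≢0) with f K ℤ.≟ + 0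
... | no fK≢0 = K , ≤-refl , fK≢0 , λ i K<i i<1+K → ⊥-elim (<-irrefl refl (<-≤-trans K<i (≤-pred i<1+K)))
... | yes fK≡0 with m≤n⇒m<n∨m≡n (≤-pred j<1+K)
...   | inj₂ refl = ⊥-elim (fj≢0 fK≡0)
...   | inj₁ j<K with lastNonzero K f (j , j<K , fj≢0)
...     | s , s<K , fs≢0 , beyond = s , m<n⇒m<1+n s<K , fs≢0 , beyond′
  where
  beyond′ : ∀ i → s < i → i < suc K → f i ≡ + 0
  beyond′ i s<i i<1+K with m≤n⇒m<n∨m≡n (≤-pred i<1+K)
  ... | inj₁ i<K  = beyond i s<i i<K
  ... | inj₂ refl = fK≡0

record ShortRelation (u : ℕ → ℤ) : Set where
  field
    K s       : ℕ
    d         : ℕ → ℤ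
    s<K       : s < K
    leading   : d s ≢ + 0
    vanishes  : ∀ n → sumℤ (suc s) (λ j → d j *ℤ u (K * n + j)) ≡ + 0

-- Normalising the relation: drop the trailing zero coefficients.
regular⇒shortRelation : ∀ k u → 2 ≤ k → IsRegular k u → ShortRelation u
regular⇒shortRelation k u 2≤k regular with regular⇒relation k u 2≤k regular
... | K , d , (i , di≢0) , vanishes with lastNonzero K (extend d) (toℕ i , Fin.toℕ<n i , subst (_≢ + 0) (sym (extend-toℕ d i)) di≢0)
...   | s , s<K , leading , beyond = record { K = K ; s = s ; d = extend d ; s<K = s<K ; leading = leading ; vanishes = short }
  where
  short : ∀ n → sumℤ (suc s) (λ j → extend d j *ℤ u (K * n + j)) ≡ + 0
  short n = begin
    sumℤ (suc s) (λ j → extend d j *ℤ u (K * n + j))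
      ≡⟨ sumℤ-truncate K s _ s<K (λ j s<j j<K → trans (cong (_*ℤ u (K * n + j)) (beyond j s<j j<K)) (ℤ.*-zeroˡ (u (K * n + j)))) ⟨
    sumℤ K (λ j → extend d j *ℤ u (K * n + j))               ≡⟨ sum-toℕ K (λ j → extend d j *ℤ u (K * n + j)) ⟨
    sum {K} (λ i → extend d (toℕ i) *ℤ u (K * n + toℕ i))     ≡⟨ sum-cong-≗ (λ i → cong (_*ℤ u (K * n + toℕ i)) (extend-toℕ d i)) ⟩
    sum (λ i → d i *ℤ u (K * n + toℕ i))                       ≡⟨ vanishes n ⟩
    + 0                                                         ∎
    where open ≡-Reasoning

-- The theorem: a k-regular enumeration of the ones of b would satisfy a short
-- relation along the K-kernel (regular⇒shortRelation), which must fail on the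
-- gap configuration at scale R = Σ |d j| provided by gapConfiguration.
mainTheorem4 : (l : ℕ → ℕ)
    → (∀ {a b} → a < b → l a < l b)
    → (∀ m → (baumSweet m ≡ 1) ⇔ (∃ λ n → l n ≡ m))
    → ∀ (k : ℕ) → 2 ≤ k → ¬ IsRegular k (λ n → + (l n))
mainTheorem4 l mono onesOfB k 2≤k regular =
  gap-contradiction s d (λ j → l (K * n + j)) z w Δ leading window jump narrow far (vanishes n)
  where
  open ShortRelation (regular⇒shortRelation k (λ n → + (l n)) 2≤k regular)
  open Gaps l mono onesOfB
  open GapConfiguration (gapConfiguration K s s<K (sumℕ (suc s) (λ j → ∣ d j ∣)))
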